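{- For any p-string $T$ of length $n$ (terminating with the unique end-marker $\$$), the parameterized suffix tray $\mathsf{PSTray}(T)$ occupies $O(n)$ space.
   Context: $\Sigma$ (static alphabet) and $\Pi$ (parameterized alphabet) are disjoint ordered alphabets; a p-string is a string over $\Sigma\cup\Pi$; every character of $\Pi$ is smaller than every character of $\Sigma$. $T$ ends with $\$\in\Sigma$, occurring nowhere else and larger than all other characters. Two p-strings $x,y$ of equal length p-match ($x\approx y$) if there is a bijection $f$ on $\Sigma\cup\Pi$ that is the identity on $\Sigma$ with $x[i]=f(y[i])$ for all $i$. The previous encoding $\mathrm{prev}(w)$ of a p-string $w$ has length $|w|$, with $\mathrm{prev}(w)[i]=w[i]$ if $w[i]\in\Sigma$, $=0$ if $w[i]\in\Pi$ does not occur in $w[1..i-1]$, and $=i-j$ otherwise, where $j<i$ is the largest index with $w[j]=w[i]$. Encoded strings are compared lexicographically with integers ordered naturally and smaller than all characters of $\Sigma$. $\mathrm{spe}(w)$ is the lexicographically smallest p-string $u$ with $u\approx w$. $\mathsf{PSTree}(T)$ is the compacted trie of $\{\mathrm{prev}(T[i..|T|]) : 1\le i\le |T|\}$, with children ordered lexicographically; nodes are identified with the strings they represent. $\mathsf{PSA}(T)$ is the array with $\mathsf{PSA}(T)[i]=j$ iff $\mathrm{prev}(T[j..|T|])$ is the $i$-th lexicographically smallest among $\{\mathrm{prev}(T[k..|T|])\}$. $\mathsf{PLCP}(T)[1]=0$ and for $i\ge2$, $\mathsf{PLCP}(T)[i]$ is the length of the longest common prefix of $\mathrm{prev}(T[\mathsf{PSA}(T)[i-1]..])$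 and $\mathrm{prev}(T[\mathsf{PSA}(T)[i]..])$. Let $\Sigma_T,\Pi_T$ be the characters of $\Sigma$, resp. $\Pi$, occurring in $T$, $\sigma=|\Sigma_T|$, $\pi=|\Pi_T|$, and for $x\in\Sigma_T\cup\Pi_T$ let $\mathrm{rank}(x)$ be the rank of $x$ in $\Pi_T\cup\Sigma_T$. A node of $\mathsf{PSTree}(T)$ is a p-node if its subtree has at least $\max\{\sigma,\pi\}$ leaves, and a branching p-node if moreover at least two of its children are p-nodes. For a branching p-node $\mathrm{prev}(v)$ ($v$ a substring of $T$), its p-array $A(\mathrm{prev}(v))$ is an array of length $\sigma+\pi$ whose entry $\mathrm{rank}(x)$ is a pointer to the child $u$ of $\mathrm{prev}(v)$ such that $\mathrm{prev}(\mathrm{spe}(v)x)$ is a prefix of $u$, or nil if no such child exists. The parameterized suffix tray $\mathsf{PSTray}(T)$ consists of $\mathsf{PSA}(T)$, $\mathsf{PLCP}(T)$, and $\mathsf{PSTree}(T)$ in which each branching p-node is augmented with its p-array. -}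

module Defs where

open import Data.Nat using (ℕ; zero; suc; _+_; _*_; _≤ᵇ_; _≡ᵇ_; _⊔_; _<ᵇ_)
open import Data.Bool using (Bool; true; false; _∧_; _∨_; not; if_then_else_)
open import Data.List using (List; []; _∷_; length; map; concatMap; take; drop; filterᵇ; deduplicateᵇ; upTo; head)
open import Data.Maybe using (Maybe; just; nothing; fromMaybe)
import Data.Maybe as M
open import Data.Bool.ListAction using (any)

-- Characters of p-strings.
--   pc a : the parameterized character number a   (a ∈ Π)
--   sc a : the static character number a          (a ∈ Σ, different from $)
--   dol  : the end marker $ ∈ Σ
-- (Order: pc _ < sc _ < dol, each family ordered by its index; the order
--  plays no role in the space bound.)
data Sym : Set where
  pc  : ℕ → Sym
  sc  : ℕ → Sym
  dol : Sym

_==S_ : Sym → Sym → Bool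
pc a ==S pc b = a ≡ᵇ b
sc a ==S sc b = a ≡ᵇ b
dol  ==S dol  = true
_    ==S _    = false

data Enc : Set where
  int : ℕ → Enc
  st  : ℕ → Enc
  edol : Enc

_==E_ : Enc → Enc → Bool
int a ==E int b = a ≡ᵇ b
st a  ==E st b  = a ≡ᵇ b
edol  ==E edol  = true
_     ==E _     = false

_==L_ : List Enc → List Enc → Bool
[]       ==L []       = true
(x ∷ xs) ==L (y ∷ ys) = (x ==E y) ∧ (xs ==L ys)
_        ==L _        = false

-- prev encoding.
-- dist a h : 1-based position of the first occurrence of the parameterized
-- character a in h, where h is the history read backwards (h's head is the
-- immediately preceding character), i.e. the distance i - j.
dist : ℕ → List Sym → Maybe ℕ
dist a []           = nothing
dist a (pc b ∷ h)   = if a ≡ᵇ b then just 1 else M.map suc (dist a h)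
dist a (_ ∷ h)      = M.map suc (dist a h)

prevH : List Sym → List Sym → List Enc
prevH h []          = []
prevH h (pc a ∷ w)  = int (fromMaybe 0 (dist a h)) ∷ prevH (pc a ∷ h) w
prevH h (sc a ∷ w)  = st a ∷ prevH (sc a ∷ h) w
prevH h (dol ∷ w)   = edol ∷ prevH (dol ∷ h) w

prev : List Sym → List Enc
prev = prevH []

suffs : List Sym → List (List Sym)
suffs []       = []
suffs (x ∷ xs) = (x ∷ xs) ∷ suffs xs

PSuf : List Sym → List (List Enc)
PSuf T = map prev (suffs T)

-- The compacted trie PSTree(T); nodes are identified with strings.

isPrefix : List Enc → List Enc → Bool
isPrefix x y = take (length x) y ==L x

isProperPrefix : List Enc → List Enc → Bool
isProperPrefix x y = isPrefix x y ∧ (length x <ᵇ length y)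

memL : List Enc → List (List Enc) → Bool
memL x = any (x ==L_)

nexts : List Sym → List Enc → List Enc
nexts T x = deduplicateᵇ _==E_
  (concatMap (λ s → if isPrefix x s then take 1 (drop (length x) s) else []) (PSuf T))

-- x is a node of the compacted trie: the root, a leaf, or a branching
-- (≥ 2 distinct continuations) internal node
isNode : List Sym → List Enc → Bool
isNode T [] = true
isNode T x@(_ ∷ _) = memL x (PSuf T) ∨ (2 ≤ᵇ length (nexts T x))

candidates : List Sym → List (List Enc)
candidates T = concatMap (λ s → map (λ k → take k s) (upTo (suc (length s)))) (PSuf T)

nodes : List Sym → List (List Enc)
nodes T = deduplicateᵇ _==L_ (filterᵇ (isNode T) (candidates T))

children : List Sym → List Enc → List (List Enc)
children T x = filterᵇ
  (λ y → isProperPrefix x y ∧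
         not (any (λ z → isProperPrefix x z ∧ isProperPrefix z y) (nodes T)))
  (nodes T)

leaves : List Sym → List Enc → ℕ
leaves T x = length (filterᵇ (isPrefix x) (PSuf T))

isStatic : Sym → Bool
isStatic (pc _) = false
isStatic _      = true

isParam : Sym → Bool
isParam (pc _) = true
isParam _      = false

σ : List Sym → ℕ
σ T = length (deduplicateᵇ _==S_ (filterᵇ isStatic T))

π : List Sym → ℕ
π T = length (deduplicateᵇ _==S_ (filterᵇ isParam T))

isPNode : List Sym → List Enc → Bool
isPNode T x = (σ T ⊔ π T) ≤ᵇ leaves T x

isBranchingPNode : List Sym → List Enc → Bool
isBranchingPNode T x = isPNode T x ∧ (2 ≤ᵇ length (filterᵇ (isPNode T) (children T x)))

branchingPNodes : List Sym → List (List Enc)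
branchingPNodes T = filterᵇ (isBranchingPNode T) (nodes T)

-- Space (in words) of PSTray(T):
--   PSA(T) : |T| entries, PLCP(T) : |T| entries,
--   PSTree(T) : one record per node (edges = nodes - 1, charged to the child),
--   one p-array of σ + π entries per branching p-node.
PSTraySpace : List Sym → ℕ
PSTraySpace T = length T + length T + length (nodes T)
              + length (branchingPNodes T) * (σ T + π T)

-- Besides the 2n words of PSA and PLCP, PSTray(T) stores the nodes of PSTree(T) and one
-- p-array of σ + π ≤ 2 max{σ, π} words per branching p-node, so both of these must be
-- bounded in terms of the n suffixes (the leaves).
--
-- Call a string x "m-branching" if two distinct one-letter extensions of x are each a
-- prefix of at least m of the n suffixes. Any set L of such strings satisfies |L| · m ≤ n:
-- take a longest x ∈ L and delete the ≥ m suffixes below one heavy extension x c. Every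
-- other y ∈ L stays m-branching: if a heavy extension y g of y is a prefix of x, it still
-- lies above the untouched suffixes below the other heavy extension x d of x; otherwise
-- no suffix below y g was deleted, since y g and x c are incomparable (|y| ≤ |x|, y ≠ x).
--
-- Branching p-nodes are (max{σ, π})-branching, as distinct children of a node start with
-- distinct letters; nodes that are neither the root nor a suffix are 1-branching. Hence there
-- are at most n / max{σ, π} branching p-nodes and at most 2n + 1 nodes, and
-- |PSTray(T)| ≤ 7n.

module Submission where

open import Defs
open import Data.Bool using (true; T; not; _∧_; if_then_else_)
open import Data.Bool.ListAction using (any)
open import Data.Bool.Properties using (T-∧; T-∨; T-not-≡)
open import Data.Empty using (⊥-elim)
open import Data.List
  using (List; []; _∷_; length; _++_; [_]; _∷ʳ_; take; drop; map; upTo;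
         filter; filterᵇ; deduplicate; deduplicateᵇ)
open import Data.List.Properties
  using (length-++; length-map; ≡-dec; ∷ʳ-injectiveˡ; filter-≐; filter-idem; filter-notAll; filter-some)
open import Data.List.Membership.Propositional using (_∈_; _∉_; find; lose)
open import Data.List.Membership.Propositional.Properties
  using (∈-concatMap⁻; ∈-concatMap⁺; ∈-map⁻; ∈-map⁺; ∈-upTo⁺;
         ∈-filter⁻; ∈-filter⁺; ∈-deduplicate⁻; ∈-deduplicate⁺)
open import Data.List.Relation.Binary.Pointwise using (Pointwise-≡⇒≡)
import Data.List.Relation.Binary.Pointwise as Pointwise
open import Data.List.Relation.Binary.Prefix.Heterogeneous using (Prefix; []; _∷_; _++ᵖ_)
open import Data.List.Relation.Binary.Prefix.Heterogeneous.Properties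
  using (fromPointwise; toPointwise; length-mono; prefix?) renaming (trans to Prefix-trans)
import Data.List.Relation.Binary.Sublist.Propositional as Sublist
open import Data.List.Relation.Binary.Sublist.Propositional.Properties using (filter⁺; length-mono-≤)
open import Data.List.Relation.Binary.Subset.Propositional using (_⊆_)
open import Data.List.Relation.Unary.All using (All; []; _∷_)
import Data.List.Relation.Unary.All as All
open import Data.List.Relation.Unary.All.Properties using (all-filter)
open import Data.List.Relation.Unary.AllPairs using ([]; _∷_)
open import Data.List.Relation.Unary.Any using (here; there)
import Data.List.Relation.Unary.Any as Any
open import Data.List.Relation.Unary.Any.Properties using (any⁺; any⁻)
open import Data.List.Relation.Unary.Unique.Propositional using (Unique)
import Data.List.Relation.Unary.Unique.Propositional.Properties as Unique
open import Data.List.Relation.Unary.Unique.DecPropositional.Properties using (deduplicate-!)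
open import Data.Nat using (ℕ; zero; suc; _+_; _*_; _≤_; _<_; z≤n; s≤s; _⊔_)
open import Data.Nat.Properties
open import Data.Nat.Tactic.RingSolver using (solve-∀)
open import Data.Product using (∃-syntax; ∃₂; _×_; _,_; proj₁; proj₂)
import Data.Product as Product
open import Data.Sum using (_⊎_; inj₁; inj₂)
import Data.Sum as Sum
open import Data.Unit using (tt)
open import Function using (_∘_)
open import Function.Bundles using (Equivalence)
open import Level using (0ℓ)
open import Relation.Binary.Core using (Rel)
open import Relation.Binary.Definitions using (DecidableEquality; Decidable)
open import Relation.Binary.PropositionalEquality
  using (_≡_; _≢_; refl; sym; trans; cong; cong₂; subst; subst₂)
import Relation.Binary.PropositionalEquality as ≡
open import Relation.Nullary using (¬_; yes; no; contradiction)
open import Relation.Nullary.Decidable using (T?; map′)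
open import Relation.Unary as U using (Pred; ∁; _≐_)
open import Relation.Unary.Properties using (∁?)

open Equivalence using (to; from)

-- Prefixes

module _ {A : Set} where

  infix 4 _⊑_ _⊏_

  _⊑_ : List A → List A → Set
  _⊑_ = Prefix _≡_

  _⊏_ : List A → List A → Set
  xs ⊏ ys = xs ⊑ ys × length xs < length ys

  length-∷ʳ : ∀ (xs : List A) a → length (xs ∷ʳ a) ≡ suc (length xs)
  length-∷ʳ xs a = trans (length-++ xs) (+-comm (length xs) 1)

  ⊑-refl : ∀ xs → xs ⊑ xs
  ⊑-refl xs = fromPointwise (Pointwise.refl refl)

  ⊑-trans : ∀ {xs ys zs} → xs ⊑ ys → ys ⊑ zs → xs ⊑ zs
  ⊑-trans = Prefix-trans ≡.trans

  ⊑-∷ʳ : ∀ xs {a} → xs ⊑ xs ∷ʳ a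
  ⊑-∷ʳ xs {a} = ⊑-refl xs ++ᵖ [ a ]

  take-⊑ : ∀ k xs → take k xs ⊑ xs
  take-⊑ zero    _        = []
  take-⊑ (suc k) []       = []
  take-⊑ (suc k) (x ∷ xs) = refl ∷ take-⊑ k xs

  ⊑⇒take≡ : ∀ {xs ys} → xs ⊑ ys → take (length xs) ys ≡ xs
  ⊑⇒take≡ []         = refl
  ⊑⇒take≡ (refl ∷ p) = cong (_ ∷_) (⊑⇒take≡ p)

  ⊑-by-length : ∀ {xs ys zs} → xs ⊑ zs → ys ⊑ zs → length xs ≤ length ys → xs ⊑ ys
  ⊑-by-length []         _          _       = []
  ⊑-by-length (refl ∷ p) (refl ∷ q) (s≤s l) = refl ∷ ⊑-by-length p q l

  ⊑∧≢⇒⊏ : ∀ {xs ys} → xs ⊑ ys → xs ≢ ys → xs ⊏ ys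
  ⊑∧≢⇒⊏ p xs≢ys = p , ≤∧≢⇒< (length-mono p) (λ e → xs≢ys (Pointwise-≡⇒≡ (toPointwise e p)))

  ∷ʳ⊑⇒⊏ : ∀ xs {a ys} → xs ∷ʳ a ⊑ ys → xs ⊏ ys
  ∷ʳ⊑⇒⊏ []       (_ ∷ _)    = [] , s≤s z≤n
  ∷ʳ⊑⇒⊏ (x ∷ xs) (refl ∷ p) = Product.map (refl ∷_) s≤s (∷ʳ⊑⇒⊏ xs p)

  ⊏⇒∷ʳ⊑ : ∀ {xs ys} → xs ⊏ ys → ∃[ a ] xs ∷ʳ a ⊑ ys
  ⊏⇒∷ʳ⊑ {ys = y ∷ _} ([]       , _)     = y , refl ∷ []
  ⊏⇒∷ʳ⊑              (refl ∷ p , s≤s l) = Product.map₂ (refl ∷_) (⊏⇒∷ʳ⊑ (p , l))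

  ∷ʳ⊑-injective : ∀ xs {a b zs} → xs ∷ʳ a ⊑ zs → xs ∷ʳ b ⊑ zs → a ≡ b
  ∷ʳ⊑-injective []       (refl ∷ _) (refl ∷ _) = refl
  ∷ʳ⊑-injective (x ∷ xs) (refl ∷ p) (refl ∷ q) = ∷ʳ⊑-injective xs p q

  ⊑-∷ʳ⁻ : ∀ {ys} xs {a} → ys ⊑ xs ∷ʳ a → ys ⊑ xs ⊎ ys ≡ xs ∷ʳ a
  ⊑-∷ʳ⁻ []       []          = inj₁ []
  ⊑-∷ʳ⁻ []       (refl ∷ []) = inj₂ refl
  ⊑-∷ʳ⁻ (x ∷ xs) []          = inj₁ []
  ⊑-∷ʳ⁻ (x ∷ xs) (refl ∷ p)  = Sum.map (refl ∷_) (cong (x ∷_)) (⊑-∷ʳ⁻ xs p)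

  ∈-next⁻ : ∀ {xs ys a} → xs ⊑ ys → a ∈ take 1 (drop (length xs) ys) → xs ∷ʳ a ⊑ ys
  ∈-next⁻ {ys = _ ∷ _} []         (here refl) = refl ∷ []
  ∈-next⁻              (refl ∷ p) a∈          = refl ∷ ∈-next⁻ p a∈

  ∈-next⁺ : ∀ xs {a ys} → xs ∷ʳ a ⊑ ys → a ∈ take 1 (drop (length xs) ys)
  ∈-next⁺ []       (refl ∷ _) = here refl
  ∈-next⁺ (_ ∷ xs) (refl ∷ p) = ∈-next⁺ xs p

  record Fork (xs ys : List A) : Set where
    constructor fork
    field
      stem       : List A
      left right : A
      left≢right : left ≢ right
      stem-left  : stem ∷ʳ left ⊑ xs
      stem-right : stem ∷ʳ right ⊑ ys

  ⊑-stem : ∀ {ws xs ys} (f : Fork xs ys) → ws ⊑ xs → ws ⊑ ys → ws ⊑ Fork.stem f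
  ⊑-stem {ws} (fork z a b a≢b za zb) wx wy with length ws ≤? length z
  ... | yes ws≤z = ⊑-by-length wx (⊑-trans (⊑-∷ʳ z) za) ws≤z
  ... | no  ws≰z = ⊥-elim (a≢b (∷ʳ⊑-injective z (below za wx) (below zb wy)))
    where
    below : ∀ {c zs} → z ∷ʳ c ⊑ zs → ws ⊑ zs → z ∷ʳ c ⊑ ws
    below {c} zc wzs = ⊑-by-length zc wzs (≤-trans (≤-reflexive (length-∷ʳ z c)) (≰⇒> ws≰z))

  module _ (_≟_ : DecidableEquality A) where

    ⊑-compare : ∀ xs ys → xs ⊑ ys ⊎ ys ⊑ xs ⊎ Fork xs ys
    ⊑-compare []       _        = inj₁ []
    ⊑-compare (x ∷ xs) []       = inj₂ (inj₁ [])
    ⊑-compare (x ∷ xs) (y ∷ ys) with x ≟ y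
    ... | no x≢y   = inj₂ (inj₂ (fork [] x y x≢y (refl ∷ []) (refl ∷ [])))
    ... | yes refl with ⊑-compare xs ys
    ... | inj₁ p        = inj₁ (refl ∷ p)
    ... | inj₂ (inj₁ p) = inj₂ (inj₁ (refl ∷ p))
    ... | inj₂ (inj₂ (fork z a b a≢b za zb)) =
      inj₂ (inj₂ (fork (x ∷ z) a b a≢b (refl ∷ za) (refl ∷ zb)))

-- Filters and duplicates

module _ {A : Set} where

  length-filter-∁ : ∀ {ℓ} {P : Pred A ℓ} (P? : U.Decidable P) xs →
                    length (filter P? xs) + length (filter (∁? P?) xs) ≡ length xs
  length-filter-∁ P? []       = refl
  length-filter-∁ P? (x ∷ xs) with P? x
  ... | yes _ = cong suc (length-filter-∁ P? xs)
  ... | no  _ = trans (+-suc _ _) (cong suc (length-filter-∁ P? xs))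

  length-filter-mono : ∀ {ℓ} {P Q : Pred A ℓ} (P? : U.Decidable P) (Q? : U.Decidable Q) →
                       (∀ {x} → P x → Q x) → ∀ xs → length (filter P? xs) ≤ length (filter Q? xs)
  length-filter-mono P? Q? P⇒Q xs = length-mono-≤ (filter⁺ P? Q? (λ { refl → P⇒Q }) (Sublist.⊆-refl {x = xs}))

  deduplicate-cong : ∀ {R Q : Rel A 0ℓ} (R? : Decidable R) (Q? : Decidable Q) →
                     (∀ {x y} → R x y → Q x y) → (∀ {x y} → Q x y → R x y) →
                     ∀ xs → deduplicate R? xs ≡ deduplicate Q? xs
  deduplicate-cong R? Q? R⇒Q Q⇒R []       = refl
  deduplicate-cong {R} {Q} R? Q? R⇒Q Q⇒R (x ∷ xs) = cong (x ∷_) (begin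
    filter (∁? (R? x)) (deduplicate R? xs) ≡⟨ filter-≐ (∁? (R? x)) (∁? (Q? x)) ¬R≐¬Q (deduplicate R? xs) ⟩
    filter (∁? (Q? x)) (deduplicate R? xs) ≡⟨ cong (filter (∁? (Q? x))) (deduplicate-cong R? Q? R⇒Q Q⇒R xs) ⟩
    filter (∁? (Q? x)) (deduplicate Q? xs) ∎)
    where
    open ≡.≡-Reasoning
    ¬R≐¬Q : ∁ (R x) ≐ ∁ (Q x)
    ¬R≐¬Q = (_∘ Q⇒R) , (_∘ R⇒Q)

  unique∧all≡⇒length≤1 : ∀ {z} {xs : List A} → Unique xs → All (_≡ z) xs → length xs ≤ 1
  unique∧all≡⇒length≤1 []              []                = z≤n
  unique∧all≡⇒length≤1 (_ ∷ [])        (_ ∷ [])          = s≤s z≤n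
  unique∧all≡⇒length≤1 ((x≢y ∷ _) ∷ _) (refl ∷ refl ∷ _) = ⊥-elim (x≢y refl)

  unique∧2≤length⇒distinct : ∀ {xs : List A} → Unique xs → 2 ≤ length xs →
                             ∃₂ λ a b → a ≢ b × a ∈ xs × b ∈ xs
  unique∧2≤length⇒distinct {a ∷ b ∷ _} ((a≢b ∷ _) ∷ _) _ =
    a , b , a≢b , here refl , there (here refl)
  unique∧2≤length⇒distinct {_ ∷ []}    _ (s≤s ())

  distinct⇒2≤length : ∀ {a b} {xs : List A} → a ∈ xs → b ∈ xs → a ≢ b → 2 ≤ length xs
  distinct⇒2≤length {xs = _ ∷ _ ∷ _} _           _           _   = s≤s (s≤s z≤n)
  distinct⇒2≤length {xs = _ ∷ []}    (here refl) (here refl) a≢b = ⊥-elim (a≢b refl)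

  module _ (_≟_ : DecidableEquality A) where

    unique⇒length≤ : ∀ {xs ys : List A} → Unique xs → xs ⊆ ys → length xs ≤ length ys
    unique⇒length≤ {[]}          _          _     = z≤n
    unique⇒length≤ {x ∷ xs} {ys} (x∉xs ∷ u) xs⊆ys = begin
      suc (length xs)         ≤⟨ s≤s (unique⇒length≤ u xs⊆ys-x) ⟩
      suc (length (ys - x))   ≤⟨ filter-notAll (∁? (_≟ x)) ys (lose (xs⊆ys (here refl)) λ x≢x → x≢x refl) ⟩
      length ys               ∎
      where
      open ≤-Reasoning
      _-_ : List A → A → List A
      ys - x = filter (∁? (_≟ x)) ys
      xs⊆ys-x : xs ⊆ ys - x
      xs⊆ys-x y∈xs = ∈-filter⁺ (∁? (_≟ x)) (xs⊆ys (there y∈xs)) λ y≡x → All.lookup x∉xs y∈xs (sym y≡x)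

    length≤1+length-filter≢ : ∀ {xs : List A} x → Unique xs →
                              length xs ≤ suc (length (filter (∁? (_≟ x)) xs))
    length≤1+length-filter≢ {xs} x u = begin
      length xs                                                  ≡⟨ length-filter-∁ (_≟ x) xs ⟨
      length (filter (_≟ x) xs) + length (filter (∁? (_≟ x)) xs) ≤⟨ +-monoˡ-≤ _ at-most-one ⟩
      suc (length (filter (∁? (_≟ x)) xs))                       ∎
      where
      open ≤-Reasoning
      at-most-one : length (filter (_≟ x) xs) ≤ 1
      at-most-one = unique∧all≡⇒length≤1 (Unique.filter⁺ (_≟ x) u) (all-filter (_≟ x) xs)

  longest : ∀ (x : List A) xs → ∃[ y ] y ∈ x ∷ xs × All (λ z → length z ≤ length y) (x ∷ xs)
  longest x []       = x , here refl , ≤-refl ∷ []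
  longest x (z ∷ xs) with longest z xs
  ... | y , y∈ , y-longest with ≤-total (length x) (length y)
  ... | inj₁ x≤y = y , there y∈ , x≤y ∷ y-longest
  ... | inj₂ y≤x = x , here refl , ≤-refl ∷ All.map (λ z≤y → ≤-trans z≤y y≤x) y-longest

-- Counting strings below heavy branching nodes

module PrefixCounting {A : Set} (_≟_ : DecidableEquality A) where

  infix 4 _⊑?_

  _⊑?_ : Decidable (_⊑_ {A})
  _⊑?_ = prefix? _≟_

  count : List (List A) → List A → ℕ
  count S x = length (filter (x ⊑?_) S)

  Branching : ℕ → List (List A) → List A → Set
  Branching m S x = ∃₂ λ a b → a ≢ b × m ≤ count S (x ∷ʳ a) × m ≤ count S (x ∷ʳ b)

  prune : List A → List (List A) → List (List A)
  prune w = filter (∁? (w ⊑?_))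

  count-antimono : ∀ S {u v} → u ⊑ v → count S v ≤ count S u
  count-antimono S u⊑v = length-filter-mono (_ ⊑?_) (_ ⊑?_) (⊑-trans u⊑v) S

  count-prune : ∀ S {u v w} → (∀ {s} → u ⊑ s → v ⊑ s × ¬ w ⊑ s) →
                count S u ≤ count (prune w S) v
  count-prune S {u} {v} {w} below-u = begin
    count S u                                  ≡⟨ cong length (filter-idem (u ⊑?_) S) ⟨
    length (filter (u ⊑?_) (filter (u ⊑?_) S))
      ≤⟨ length-mono-≤ (filter⁺ (u ⊑?_) (v ⊑?_) (λ { refl → proj₁ ∘ below-u }) below-u⊆kept) ⟩
    count (prune w S) v                        ∎
    where
    open ≤-Reasoning
    below-u⊆kept : filter (u ⊑?_) S Sublist.⊆ prune w S
    below-u⊆kept = filter⁺ (u ⊑?_) (∁? (w ⊑?_)) (λ { refl → proj₂ ∘ below-u }) (Sublist.⊆-refl {x = S})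

  branching-prune : ∀ {m S x y c d} → c ≢ d → m ≤ count S (x ∷ʳ d) → y ≢ x → length y ≤ length x →
                    Branching m S y → Branching m (prune (x ∷ʳ c) S) y
  branching-prune {m} {S} {x} {y} {c} {d} c≢d heavy-d y≢x y≤x (a , b , a≢b , heavy-a , heavy-b) =
    a , b , a≢b , survives a heavy-a , survives b heavy-b
    where
    survives : ∀ g → m ≤ count S (y ∷ʳ g) → m ≤ count (prune (x ∷ʳ c) S) (y ∷ʳ g)
    survives g heavy-g with y ∷ʳ g ⊑? x
    ... | yes yg⊑x = ≤-trans heavy-d (count-prune S λ xd⊑s →
      ⊑-trans yg⊑x (⊑-trans (⊑-∷ʳ x) xd⊑s) , λ xc⊑s → c≢d (∷ʳ⊑-injective x xc⊑s xd⊑s))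
    ... | no  yg⋢x = ≤-trans heavy-g (count-prune S λ yg⊑s → yg⊑s , disjoint yg⊑s)
      where
      yg≤xc : length (y ∷ʳ g) ≤ length (x ∷ʳ c)
      yg≤xc = subst₂ _≤_ (sym (length-∷ʳ y g)) (sym (length-∷ʳ x c)) (s≤s y≤x)
      disjoint : ∀ {s} → y ∷ʳ g ⊑ s → ¬ x ∷ʳ c ⊑ s
      disjoint yg⊑s xc⊑s with ⊑-∷ʳ⁻ x (⊑-by-length yg⊑s xc⊑s yg≤xc)
      ... | inj₁ yg⊑x  = yg⋢x yg⊑x
      ... | inj₂ yg≡xc = y≢x (∷ʳ-injectiveˡ y x yg≡xc)

  branching-count : ∀ m S L → Unique L → All (Branching m S) L → length L * m ≤ length S
  branching-count m S L = go (length L) S L ≤-refl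
    where
    _≟L_ : DecidableEquality (List A)
    _≟L_ = ≡-dec _≟_

    go : ∀ k S L → length L ≤ k → Unique L → All (Branching m S) L → length L * m ≤ length S
    go _       S []           _ _ _ = z≤n
    go zero    S (_ ∷ _)      ()
    go (suc k) S L@(x₀ ∷ L₀) L≤1+k uL bL with longest x₀ L₀
    ... | x , x∈L , x-longest with All.lookup bL x∈L
    ... | c , d , c≢d , heavy-c , heavy-d = begin
      length L * m                 ≤⟨ *-monoˡ-≤ m (length≤1+length-filter≢ _≟L_ x uL) ⟩
      m + length L′ * m            ≤⟨ +-mono-≤ heavy-c (go k S′ L′ L′≤k (Unique.filter⁺ (∁? (_≟L x)) uL) bL′) ⟩
      count S (x ∷ʳ c) + length S′ ≡⟨ length-filter-∁ ((x ∷ʳ c) ⊑?_) S ⟩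
      length S                     ∎
      where
      open ≤-Reasoning
      L′ = filter (∁? (_≟L x)) L
      S′ = prune (x ∷ʳ c) S
      L′≤k : length L′ ≤ k
      L′≤k = ≤-pred (<-≤-trans (filter-notAll (∁? (_≟L x)) L (lose x∈L λ x≢x → x≢x refl)) L≤1+k)
      bL′ : All (Branching m S′) L′
      bL′ = All.tabulate λ y∈L′ → let (y∈L , y≢x) = ∈-filter⁻ (∁? (_≟L x)) y∈L′ in
        branching-prune {S = S} c≢d heavy-d y≢x (All.lookup x-longest y∈L) (All.lookup bL y∈L)

-- The Boolean tests of the definitions

==E⇒≡ : ∀ a b → T (a ==E b) → a ≡ b
==E⇒≡ (int a) (int b) h = cong int (≡ᵇ⇒≡ a b h)
==E⇒≡ (st a)  (st b)  h = cong st (≡ᵇ⇒≡ a b h)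
==E⇒≡ edol    edol    _ = refl

==E-refl : ∀ a → T (a ==E a)
==E-refl (int a) = ≡⇒≡ᵇ a a refl
==E-refl (st a)  = ≡⇒≡ᵇ a a refl
==E-refl edol    = tt

==L-refl : ∀ x → T (x ==L x)
==L-refl []      = tt
==L-refl (a ∷ x) = from T-∧ (==E-refl a , ==L-refl x)

==L⇒≡ : ∀ x y → T (x ==L y) → x ≡ y
==L⇒≡ []      []      _ = refl
==L⇒≡ (a ∷ x) (b ∷ y) h with to T-∧ h
... | a==b , x==y = cong₂ _∷_ (==E⇒≡ a b a==b) (==L⇒≡ x y x==y)

_≟E_ : DecidableEquality Enc
a ≟E b = map′ (==E⇒≡ a b) (λ { refl → ==E-refl a }) (T? (a ==E b))

_≟L_ : DecidableEquality (List Enc)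
_≟L_ = ≡-dec _≟E_

open PrefixCounting _≟E_ public

isPrefix⇒⊑ : ∀ x s → T (isPrefix x s) → x ⊑ s
isPrefix⇒⊑ []      _       _ = []
isPrefix⇒⊑ (a ∷ x) (b ∷ s) h with ==E⇒≡ b a (proj₁ (to T-∧ h))
... | refl = refl ∷ isPrefix⇒⊑ x s (proj₂ (to T-∧ h))

⊑⇒isPrefix : ∀ {x s} → x ⊑ s → T (isPrefix x s)
⊑⇒isPrefix []                 = tt
⊑⇒isPrefix {a ∷ _} (refl ∷ p) = from T-∧ (==E-refl a , ⊑⇒isPrefix p)

isProperPrefix⇒⊏ : ∀ x y → T (isProperPrefix x y) → x ⊏ y
isProperPrefix⇒⊏ x y h with to T-∧ h
... | x⊑y , x<y = isPrefix⇒⊑ x y x⊑y , <ᵇ⇒< (length x) (length y) x<y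

⊏⇒isProperPrefix : ∀ {x y} → x ⊏ y → T (isProperPrefix x y)
⊏⇒isProperPrefix (p , l) = from T-∧ (⊑⇒isPrefix p , <⇒<ᵇ l)

memL⇒∈ : ∀ x S → T (memL x S) → x ∈ S
memL⇒∈ x S h = Any.map (λ {y} → ==L⇒≡ x y) (any⁻ (x ==L_) S h)

filter-isPrefix : ∀ x S → filterᵇ (isPrefix x) S ≡ filter (x ⊑?_) S
filter-isPrefix x = filter-≐ (T? ∘ isPrefix x) (x ⊑?_) ((λ {s} → isPrefix⇒⊑ x s) , ⊑⇒isPrefix)

deduplicate-==E : ∀ xs → deduplicateᵇ _==E_ xs ≡ deduplicate _≟E_ xs
deduplicate-==E = deduplicate-cong _ _ (λ {a} {b} → ==E⇒≡ a b) (λ { {a} refl → ==E-refl a })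

deduplicate-==L : ∀ xs → deduplicateᵇ _==L_ xs ≡ deduplicate _≟L_ xs
deduplicate-==L = deduplicate-cong _ _ (λ {x} {y} → ==L⇒≡ x y) (λ { {x} refl → ==L-refl x })

leaves≡count : ∀ T₀ x → leaves T₀ x ≡ count (PSuf T₀) x
leaves≡count T₀ x = cong length (filter-isPrefix x (PSuf T₀))

-- The nodes of the parameterized suffix tree

module Trie (T₀ : List Sym) where

  open import Data.List.Membership.DecPropositional _≟L_ using (_∈?_)

  S : List (List Enc)
  S = PSuf T₀

  ∈-candidates⁻ : ∀ {y} → y ∈ candidates T₀ → ∃[ s ] s ∈ S × y ⊑ s
  ∈-candidates⁻ y∈ with find (∈-concatMap⁻ _ {xs = S} y∈)
  ... | s , s∈S , y∈prefixes with ∈-map⁻ (λ k → take k s) {xs = upTo (suc (length s))} y∈prefixes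
  ... | k , _ , refl = s , s∈S , take-⊑ k s

  ∈-candidates⁺ : ∀ {s y} → s ∈ S → y ⊑ s → y ∈ candidates T₀
  ∈-candidates⁺ {s} s∈S y⊑s = ∈-concatMap⁺ _ (lose s∈S
    (subst (_∈ map (λ k → take k s) (upTo (suc (length s)))) (⊑⇒take≡ y⊑s)
      (∈-map⁺ (λ k → take k s) (∈-upTo⁺ (s≤s (length-mono y⊑s))))))

  ∈-nexts⁻ : ∀ {x a} → a ∈ nexts T₀ x → ∃[ s ] s ∈ S × x ∷ʳ a ⊑ s
  ∈-nexts⁻ {x} a∈ with find (∈-concatMap⁻ _ {xs = S} (∈-deduplicate⁻ _ _ a∈))
  ... | s , s∈S , a∈next with isPrefix x s in x⊑?s
  -- when the test is false, a∈next : a ∈ [] and the clause is absurd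
  ... | true = s , s∈S , ∈-next⁻ (isPrefix⇒⊑ x s (subst T (sym x⊑?s) tt)) a∈next

  ∈-nexts⁺ : ∀ {s x a} → s ∈ S → x ∷ʳ a ⊑ s → a ∈ nexts T₀ x
  ∈-nexts⁺ {s} {x} {a} s∈S xa⊑s = subst (a ∈_) (sym (deduplicate-==E _))
    (∈-deduplicate⁺ _≟E_ (∈-concatMap⁺ _ (lose s∈S a∈next)))
    where
    a∈next : a ∈ (if isPrefix x s then take 1 (drop (length x) s) else [])
    a∈next with isPrefix x s | ⊑⇒isPrefix (⊑-trans (⊑-∷ʳ x) xa⊑s)
    ... | true | _ = ∈-next⁺ x xa⊑s

  nexts-unique : ∀ {x} → Unique (nexts T₀ x)
  nexts-unique = subst Unique (sym (deduplicate-==E _)) (deduplicate-! _≟E_ _)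

  two-nexts⇒branching : ∀ {x} → 2 ≤ length (nexts T₀ x) → Branching 1 S x
  two-nexts⇒branching {x} two with unique∧2≤length⇒distinct (nexts-unique {x}) two
  ... | a , b , a≢b , a∈ , b∈ = a , b , a≢b , leaf-below (∈-nexts⁻ a∈) , leaf-below (∈-nexts⁻ b∈)
    where
    leaf-below : ∀ {w} → ∃[ s ] s ∈ S × w ⊑ s → 1 ≤ count S w
    leaf-below {w} (s , s∈S , w⊑s) = filter-some (w ⊑?_) (lose s∈S w⊑s)

  nodes-unique : Unique (nodes T₀)
  nodes-unique = subst Unique (sym (deduplicate-==L _)) (deduplicate-! _≟L_ _)

  ∈-nodes⁻ : ∀ {y} → y ∈ nodes T₀ → (∃[ s ] s ∈ S × y ⊑ s) × T (isNode T₀ y)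
  ∈-nodes⁻ y∈ with ∈-filter⁻ (T? ∘ isNode T₀) (∈-deduplicate⁻ _ _ y∈)
  ... | y∈candidates , y-node = ∈-candidates⁻ y∈candidates , y-node

  ∈-nodes⁺ : ∀ {s y} → s ∈ S → y ⊑ s → T (isNode T₀ y) → y ∈ nodes T₀
  ∈-nodes⁺ s∈S y⊑s y-node = subst (_ ∈_) (sym (deduplicate-==L _))
    (∈-deduplicate⁺ _≟L_ (∈-filter⁺ (T? ∘ isNode T₀) (∈-candidates⁺ s∈S y⊑s) y-node))

  fork⇒node : ∀ {y₁ y₂} → y₁ ∈ nodes T₀ → y₂ ∈ nodes T₀ → (f : Fork y₁ y₂) → Fork.stem f ≢ [] →
              Fork.stem f ∈ nodes T₀
  fork⇒node y₁∈ y₂∈ (fork z@(_ ∷ _) a b a≢b za zb) _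
    with proj₁ (∈-nodes⁻ y₁∈) | proj₁ (∈-nodes⁻ y₂∈)
  ... | s₁ , s₁∈S , y₁⊑s₁ | s₂ , s₂∈S , y₂⊑s₂ =
    ∈-nodes⁺ s₁∈S (⊑-trans (⊑-∷ʳ z) za⊑s₁) (from T-∨ (inj₂ (≤⇒≤ᵇ (distinct⇒2≤length
      (∈-nexts⁺ {x = z} s₁∈S za⊑s₁) (∈-nexts⁺ {x = z} s₂∈S (⊑-trans zb y₂⊑s₂)) a≢b))))
    where
    za⊑s₁ = ⊑-trans za y₁⊑s₁
  fork⇒node _ _ (fork [] _ _ _ _ _) []≢[] = contradiction refl []≢[]

  ∈-children⁻ : ∀ {x y} → y ∈ children T₀ x →
                y ∈ nodes T₀ × x ⊏ y × (∀ {z} → z ∈ nodes T₀ → x ⊏ z → ¬ z ⊏ y)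
  ∈-children⁻ {x} {y} y∈ with ∈-filter⁻ (T? ∘ λ y → isProperPrefix x y ∧
                                  not (any (λ z → isProperPrefix x z ∧ isProperPrefix z y) (nodes T₀))) y∈
  ... | y∈nodes , child with to T-∧ child
  ... | x⊏y , nothing-between = y∈nodes , isProperPrefix⇒⊏ x y x⊏y , between
    where
    between : ∀ {z} → z ∈ nodes T₀ → x ⊏ z → ¬ z ⊏ y
    between z∈ x⊏z z⊏y = subst T (to T-not-≡ nothing-between)
      (any⁺ _ (lose z∈ (from T-∧ (⊏⇒isProperPrefix x⊏z , ⊏⇒isProperPrefix z⊏y))))

  children-diverge : ∀ {x y₁ y₂ c} → y₁ ∈ children T₀ x → y₂ ∈ children T₀ x → y₁ ≢ y₂ →
                     x ∷ʳ c ⊑ y₁ → ¬ x ∷ʳ c ⊑ y₂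
  children-diverge {x} {y₁} {y₂} {c} y₁∈ y₂∈ y₁≢y₂ xc⊑y₁ xc⊑y₂
    with ∈-children⁻ y₁∈ | ∈-children⁻ y₂∈ | ⊑-compare _≟E_ y₁ y₂
  ... | y₁∈nodes , _ , _ | _ , _ , between₂ | inj₁ y₁⊑y₂ =
    between₂ y₁∈nodes (∷ʳ⊑⇒⊏ x xc⊑y₁) (⊑∧≢⇒⊏ y₁⊑y₂ y₁≢y₂)
  ... | _ , _ , between₁ | y₂∈nodes , _ , _ | inj₂ (inj₁ y₂⊑y₁) =
    between₁ y₂∈nodes (∷ʳ⊑⇒⊏ x xc⊑y₂) (⊑∧≢⇒⊏ y₂⊑y₁ (y₁≢y₂ ∘ sym))
  ... | y₁∈nodes , _ , between₁ | y₂∈nodes , _ , _ | inj₂ (inj₂ f) =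
    between₁ (fork⇒node y₁∈nodes y₂∈nodes f stem≢[]) (∷ʳ⊑⇒⊏ x xc⊑stem)
      (∷ʳ⊑⇒⊏ _ (Fork.stem-left f))
    where
    xc⊑stem : x ∷ʳ c ⊑ Fork.stem f
    xc⊑stem = ⊑-stem f xc⊑y₁ xc⊑y₂
    stem≢[] : Fork.stem f ≢ []
    stem≢[] stem≡[] = n≮0 (proj₂ (∷ʳ⊑⇒⊏ x (subst (x ∷ʳ c ⊑_) stem≡[] xc⊑stem)))

  p-children : List Enc → List (List Enc)
  p-children y = filterᵇ (isPNode T₀) (children T₀ y)

  heavy-p-child : ∀ {y y′} → y′ ∈ p-children y →
                  ∃[ c ] y ∷ʳ c ⊑ y′ × σ T₀ ⊔ π T₀ ≤ count S (y ∷ʳ c)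
  heavy-p-child {y} {y′} y′∈ with ∈-filter⁻ (T? ∘ isPNode T₀) y′∈
  ... | y′∈children , p-node with ⊏⇒∷ʳ⊑ (proj₁ (proj₂ (∈-children⁻ y′∈children)))
  ... | c , yc⊑y′ = c , yc⊑y′ , ≤-trans (≤ᵇ⇒≤ _ _ p-node)
    (≤-trans (≤-reflexive (leaves≡count T₀ y′)) (count-antimono S yc⊑y′))

  branchingPNode⇒branching : ∀ {y} → y ∈ branchingPNodes T₀ → Branching (σ T₀ ⊔ π T₀) S y
  branchingPNode⇒branching {y} y∈ with ∈-filter⁻ (T? ∘ isBranchingPNode T₀) {xs = nodes T₀} y∈
  ... | _ , branching-p
    with unique∧2≤length⇒distinct (Unique.filter⁺ _ (Unique.filter⁺ _ nodes-unique))
                                   (≤ᵇ⇒≤ 2 _ (proj₂ (to T-∧ branching-p)))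
  ... | y₁ , y₂ , y₁≢y₂ , y₁∈ , y₂∈ with heavy-p-child y₁∈ | heavy-p-child y₂∈
  ... | c₁ , yc₁⊑y₁ , heavy₁ | c₂ , yc₂⊑y₂ , heavy₂ =
    c₁ , c₂ , (λ { refl → children-diverge {y} (child y₁∈) (child y₂∈) y₁≢y₂ yc₁⊑y₁ yc₂⊑y₂ }) ,
    heavy₁ , heavy₂
    where
    child : ∀ {y′} → y′ ∈ p-children y → y′ ∈ children T₀ y
    child = proj₁ ∘ ∈-filter⁻ (T? ∘ isPNode T₀)

  branchingPNodes-bound : length (branchingPNodes T₀) * (σ T₀ ⊔ π T₀) ≤ length S
  branchingPNodes-bound = branching-count _ S _ (Unique.filter⁺ _ nodes-unique)
    (All.tabulate branchingPNode⇒branching)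

  internal-node⇒branching : ∀ {y} → T (isNode T₀ y) → y ∉ S → y ≢ [] → Branching 1 S y
  internal-node⇒branching {[]}        _    _   []≢[] = contradiction refl []≢[]
  internal-node⇒branching {y@(_ ∷ _)} node y∉S _ with to T-∨ node
  ... | inj₁ y∈S = contradiction (memL⇒∈ y S y∈S) y∉S
  ... | inj₂ two = two-nexts⇒branching {y} (≤ᵇ⇒≤ 2 _ two)

  nodes-bound : length (nodes T₀) ≤ length S + (1 + length S)
  nodes-bound = begin
    length N                                   ≡⟨ length-filter-∁ (_∈? S) N ⟨
    length N∈S + length N∉S                    ≡⟨ cong (length N∈S +_) (length-filter-∁ (_≟L []) N∉S) ⟨
    length N∈S + (length roots + length inner) ≤⟨ +-mono-≤ leaf-bound (+-mono-≤ root-bound inner-bound) ⟩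
    length S + (1 + length S)                  ∎
    where
    open ≤-Reasoning
    N N∈S N∉S roots inner : List (List Enc)
    N     = nodes T₀
    N∈S   = filter (_∈? S) N
    N∉S   = filter (∁? (_∈? S)) N
    roots = filter (_≟L []) N∉S
    inner = filter (∁? (_≟L [])) N∉S
    N∉S-unique : Unique N∉S
    N∉S-unique = Unique.filter⁺ _ nodes-unique
    leaf-bound : length N∈S ≤ length S
    leaf-bound = unique⇒length≤ _≟L_ (Unique.filter⁺ _ nodes-unique)
      (proj₂ ∘ ∈-filter⁻ (_∈? S) {xs = N})
    root-bound : length roots ≤ 1
    root-bound = unique∧all≡⇒length≤1 (Unique.filter⁺ _ N∉S-unique) (all-filter (_≟L []) N∉S)
    inner-branching : ∀ {y} → y ∈ inner → Branching 1 S y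
    inner-branching {y} y∈ with ∈-filter⁻ (∁? (_≟L [])) {xs = N∉S} y∈
    ... | y∈N∉S , y≢[] with ∈-filter⁻ (∁? (_∈? S)) {xs = N} y∈N∉S
    ... | y∈N , y∉S = internal-node⇒branching (proj₂ (∈-nodes⁻ {y} y∈N)) y∉S y≢[]
    inner-bound : length inner ≤ length S
    inner-bound = ≤-trans (≤-reflexive (sym (*-identityʳ _)))
      (branching-count 1 S inner (Unique.filter⁺ _ N∉S-unique) (All.tabulate inner-branching))

-- The space bound

length-PSuf : ∀ T₀ → length (PSuf T₀) ≡ length T₀
length-PSuf T₀ = trans (length-map prev (suffs T₀)) (length-suffs T₀)
  where
  length-suffs : ∀ T₀ → length (suffs T₀) ≡ length T₀
  length-suffs []       = refl
  length-suffs (_ ∷ T₀) = cong suc (length-suffs T₀)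

PSTraySpace-bound : ∀ T₀ → 1 ≤ length T₀ → PSTraySpace T₀ ≤ 7 * length T₀
PSTraySpace-bound T₀ 1≤n = begin
  n + n + length (nodes T₀) + B * (σ T₀ + π T₀) ≤⟨ +-mono-≤ (+-monoʳ-≤ (n + n) nodes≤) p-arrays≤ ⟩
  n + n + (n + (1 + n)) + (n + n)               ≤⟨ +-monoˡ-≤ (n + n) (+-monoʳ-≤ (n + n) 1+n≤2n) ⟩
  n + n + (n + (n + n)) + (n + n)               ≡⟨ seven-n n ⟩
  7 * n                                         ∎
  where
  open ≤-Reasoning
  open Trie T₀
  n B m : ℕ
  n = length T₀
  B = length (branchingPNodes T₀)
  m = σ T₀ ⊔ π T₀
  seven-n : ∀ n → n + n + (n + (n + n)) + (n + n) ≡ 7 * n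
  seven-n = solve-∀
  1+n≤2n : n + (1 + n) ≤ n + (n + n)
  1+n≤2n = +-monoʳ-≤ n (+-monoˡ-≤ n 1≤n)
  nodes≤ : length (nodes T₀) ≤ n + (1 + n)
  nodes≤ = subst (λ k → length (nodes T₀) ≤ k + (1 + k)) (length-PSuf T₀) nodes-bound
  p-arrays≤ : B * (σ T₀ + π T₀) ≤ n + n
  p-arrays≤ = begin
    B * (σ T₀ + π T₀) ≤⟨ *-monoʳ-≤ B (+-mono-≤ (m≤m⊔n (σ T₀) (π T₀)) (m≤n⊔m (σ T₀) (π T₀))) ⟩
    B * (m + m)       ≡⟨ *-distribˡ-+ B m m ⟩
    B * m + B * m     ≤⟨ +-mono-≤ B*m≤n B*m≤n ⟩
    n + n             ∎
    where
    B*m≤n : B * m ≤ n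
    B*m≤n = subst (B * m ≤_) (length-PSuf T₀) branchingPNodes-bound

-- The bound holds for every nonempty p-string.
mainTheorem2 : ∃[ c ] (∀ (w : List Sym) → dol ∉ w →
    PSTraySpace (w ++ [ dol ]) ≤ c * length (w ++ [ dol ]))
mainTheorem2 = 7 , λ w _ →
  PSTraySpace-bound (w ++ [ dol ]) (subst (1 ≤_) (sym (length-∷ʳ w dol)) (s≤s z≤n))
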